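{- Let $n$ be a positive integer and $t$ a non-negative integer. Consider all set-valued standard tableaux with $n$ entries whose shape is $(e+t,e)$ for some non-negative integer $e$ (i.e. a straight two-rowed shape whose first row is longer than the second row by $t$), each with equal probability. The expected value of the length $e$ of the second row is $$\frac {\binom {2n-4}{n-t-1}+ (n - 2) \binom {2 n - 4} { n - t - 3}- (n + 1) \binom {2 n - 4} {n - t - 4} - \binom {n - 3} {t-2}}{\binom {2n-2}{n-t-1}-\binom {2n-2}{n-t-2}+\binom {n-2}{t-2}}.$$
   Context: Shapes: for integers $\lambda_1\ge\lambda_2\ge0$, the (straight) two-rowed shape $(\lambda_1,\lambda_2)$ consists of cells $(1,j)$, $1\le j\le\lambda_1$ (first row, on top) and $(2,j)$, $1\le j\le \lambda_2$ (second row), left-justified. A set-valued standard tableau of this shape with $n$ entries is a filling of the cells with the numbers $1,2,\dots,n$, each used exactly once, each cell receiving a nonempty set of numbers, such that every number in a cell $(i,j)$ is smaller than every number in every other cell $(i',j')$ of the shape with $i'\ge i$ and $j'\ge j$. The length of a row is its number of cells. Binomial convention: $\binom{a}{k}=a(a-1)\cdots(a-k+1)/k!$ for integers $k\ge0$ (any integer $a$) and $\binom ak=0$ for $k<0$. -}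

module Defs where

open import Data.Nat as ℕ using (ℕ; zero; suc; _≤_; _!)
open import Data.Nat.Properties using (_!≢0)
open import Data.Integer using (ℤ; 0ℤ; +_; -[1+_]; _*_; _-_; _+_; _/ℕ_)
open import Data.Fin as Fin using (Fin; toℕ)
open import Data.Vec using (Vec; lookup)
open import Data.List using (List; map; allFin)
open import Data.Nat.ListAction using (sum)
open import Data.Product using (Σ; ∃; proj₁)
open import Function.Bundles using (_↔_; Inverse)
open import Relation.Binary.PropositionalEquality using (_≡_; _≢_)

-- Binomial coefficients with the paper's convention:
--   binom a k = a(a-1)...(a-k+1)/k!  for integers k ≥ 0 (any integer a),
--   binom a k = 0                     for k < 0.

falling : ℤ → ℕ → ℤ
falling a zero    = + 1
falling a (suc k) = a * falling (a - + 1) k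

binom : ℤ → ℤ → ℤ
binom a (+ k)      = (falling a k /ℕ (k !)) {{k !≢0}}
binom a -[1+ k ] = 0ℤ

-- Two-rowed straight shape (λ₁, λ₂): cells of row 1 are `top j`
-- (j < λ₁), cells of row 2 are `bot j` (j < λ₂); columns counted from 0.

data Cell (λ₁ λ₂ : ℕ) : Set where
  top : Fin λ₁ → Cell λ₁ λ₂
  bot : Fin λ₂ → Cell λ₁ λ₂

row : ∀ {λ₁ λ₂} → Cell λ₁ λ₂ → ℕ
row (top _) = 1
row (bot _) = 2

col : ∀ {λ₁ λ₂} → Cell λ₁ λ₂ → ℕ
col (top j) = toℕ j
col (bot j) = toℕ j

-- The entries 1,…,n are represented by Fin n (i.e. 0,…,n-1, same order);
-- `fill` sends each entry to the cell containing it (so every number is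
-- used exactly once).  The proof fields are irrelevant, so a
-- tableau is determined by its filling.
record SVT (n λ₁ λ₂ : ℕ) : Set where
  constructor svt
  field
    fill        : Vec (Cell λ₁ λ₂) n
    .nonempty   : (c : Cell λ₁ λ₂) → ∃ λ (x : Fin n) → lookup fill x ≡ c
    .increasing : (x y : Fin n) → lookup fill x ≢ lookup fill y →
                  row (lookup fill x) ≤ row (lookup fill y) →
                  col (lookup fill x) ≤ col (lookup fill y) →
                  x Fin.< y

Tableaux : (n t : ℕ) → Set
Tableaux n t = Σ ℕ λ e → SVT n (e ℕ.+ t) e

-- The expected value under the uniform distribution is secondRowSum φ / N.
secondRowSum : ∀ {n t N} → Fin N ↔ Tableaux n t → ℕ
secondRowSum {N = N} φ = sum (map (λ i → proj₁ (Inverse.to φ i)) (allFin N))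

numer : ℕ → ℕ → ℤ
numer n t =
  binom (+ (2 ℕ.* n) - + 4) (+ n - + t - + 1)
  + (+ n - + 2) * binom (+ (2 ℕ.* n) - + 4) (+ n - + t - + 3)
  - (+ n + + 1) * binom (+ (2 ℕ.* n) - + 4) (+ n - + t - + 4)
  - binom (+ n - + 3) (+ t - + 2)

denom : ℕ → ℕ → ℤ
denom n t =
  binom (+ (2 ℕ.* n) - + 2) (+ n - + t - + 1)
  - binom (+ (2 ℕ.* n) - + 2) (+ n - + t - + 2)
  + binom (+ n - + 2) (+ t - + 2)

-- Removing the largest number from a set-valued tableau of shape (e + t, e)
-- leaves a tableau of the same shape or of the shape that has lost the last
-- cell of one row, so tableaux are sequences of such growth steps.  With F n t
-- their number and Q n t their total second-row length, classifying by the
-- last step gives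
--   F (n+1) t + C(n-1, t-1) = F n (t-1) + 2 F n t + F n (t+1),
--   Q (n+1) t               = Q n (t-1) + 2 Q n t + Q n (t+1) + F n (t+1),
-- where C(n-1, t-1) counts the one-row tableaux (whose second row cannot
-- receive the last number), and where at t = 0 one sets F n (-1) = - F n 0
-- and Q n (-1) = - Q n 0.  The operator f ↦ f (t-1) + 2 f t + f (t+1) raises
-- the upper index of C(N, c ± t) by two (Pascal's rule twice), so the paper's
-- denominator and numerator satisfy the same recurrences, the convention at
-- t = 0 coming down to the symmetry and absorption identities.  Both sides
-- agree for n = 3, and the denominator is nonzero because tableaux exist.
module Submission where

open import Defs
open import Data.Nat as ℕ using (ℕ; zero; suc; _≤_; _!; z≤n; s≤s)
open import Data.Integer as ℤ using (ℤ; +_; _*_; 0ℤ)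
open import Data.Fin using (Fin)
open import Data.Product using (Σ; _×_; _,_; proj₁; proj₂)
open import Function.Bundles using (_↔_; Inverse)
open import Relation.Binary.PropositionalEquality
import Data.Nat.Properties as ℕ
import Data.Integer.Properties as ℤ
open ≡-Reasoning

cong₃ : ∀ {A B C D : Set} (f : A → B → C → D) {x x′ y y′ z z′} →
        x ≡ x′ → y ≡ y′ → z ≡ z′ → f x y z ≡ f x′ y′ z′
cong₃ f refl refl refl = refl

module Binomials where

  open import Data.Integer using (-[1+_]; _+_; _-_; -_)
  open import Data.Nat.Combinatorics using (_C_; nCk≡nC[n∸k]; k>n⇒nCk≡0; nC1≡n)
    renaming (nCk+nC[k+1]≡[n+1]C[k+1] to pascal)
  open import Data.Nat.DivMod using (m*n/n≡m)
  import Data.Nat.Tactic.RingSolver as ℕ-Solver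
  import Data.Sum as Sum

  C-absorb : ∀ n k → (suc n C suc k) ℕ.* suc k ≡ suc n ℕ.* (n C k)
  C-absorb zero    zero    = refl
  C-absorb zero    (suc k) = refl
  C-absorb (suc n) zero    = cong (ℕ._* 1) (nC1≡n (suc (suc n)))
  C-absorb (suc n) (suc k) = begin
    (suc (suc n) C suc (suc k)) ℕ.* suc (suc k)
      ≡⟨ cong (ℕ._* suc (suc k)) (pascal (suc n) (suc k)) ⟨
    (a ℕ.+ b) ℕ.* suc (suc k)
      ≡⟨ split a b k ⟩
    (a ℕ.* suc k ℕ.+ b ℕ.* suc (suc k)) ℕ.+ a
      ≡⟨ cong₂ (λ x y → x ℕ.+ y ℕ.+ a) (C-absorb n k) (C-absorb n (suc k)) ⟩
    (suc n ℕ.* (n C k) ℕ.+ suc n ℕ.* (n C suc k)) ℕ.+ a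
      ≡⟨ cong (λ x → (suc n ℕ.* (n C k) ℕ.+ suc n ℕ.* (n C suc k)) ℕ.+ x) (pascal n k) ⟨
    (suc n ℕ.* (n C k) ℕ.+ suc n ℕ.* (n C suc k)) ℕ.+ ((n C k) ℕ.+ (n C suc k))
      ≡⟨ collect (suc n) (n C k) (n C suc k) ⟩
    suc (suc n) ℕ.* ((n C k) ℕ.+ (n C suc k))
      ≡⟨ cong (suc (suc n) ℕ.*_) (pascal n k) ⟩
    suc (suc n) ℕ.* (suc n C suc k) ∎
    where
    a = suc n C suc k
    b = suc n C suc (suc k)
    split : ∀ a b k → (a ℕ.+ b) ℕ.* suc (suc k) ≡ (a ℕ.* suc k ℕ.+ b ℕ.* suc (suc k)) ℕ.+ a
    split = ℕ-Solver.solve-∀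
    collect : ∀ n x y → (n ℕ.* x ℕ.+ n ℕ.* y) ℕ.+ (x ℕ.+ y) ≡ suc n ℕ.* (x ℕ.+ y)
    collect = ℕ-Solver.solve-∀

  C-absorb-sum : ∀ n k → (n C suc k) ℕ.* suc k ℕ.+ (n C k) ℕ.* k ≡ n ℕ.* (n C k)
  C-absorb-sum zero    zero    = refl
  C-absorb-sum zero    (suc k) = refl
  C-absorb-sum (suc n) zero    = trans (ℕ.+-identityʳ _) (cong (ℕ._* 1) (nC1≡n (suc n)))
  C-absorb-sum (suc n) (suc k) = begin
    (suc n C suc (suc k)) ℕ.* suc (suc k) ℕ.+ (suc n C suc k) ℕ.* suc k
      ≡⟨ cong₂ ℕ._+_ (C-absorb n (suc k)) (C-absorb n k) ⟩
    suc n ℕ.* (n C suc k) ℕ.+ suc n ℕ.* (n C k)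
      ≡⟨ ℕ.*-distribˡ-+ (suc n) (n C suc k) (n C k) ⟨
    suc n ℕ.* ((n C suc k) ℕ.+ (n C k))
      ≡⟨ cong (suc n ℕ.*_) (trans (ℕ.+-comm (n C suc k) (n C k)) (pascal n k)) ⟩
    suc n ℕ.* (suc n C suc k) ∎

  falling≡C*! : ∀ n k → falling (+ n) k ≡ + ((n C k) ℕ.* k !)
  falling≡C*! n       zero    = refl
  falling≡C*! zero    (suc k) = refl
  falling≡C*! (suc n) (suc k) = begin
    + suc n * falling (+ n) k              ≡⟨ cong (+ suc n *_) (falling≡C*! n k) ⟩
    + suc n * + ((n C k) ℕ.* k !)          ≡⟨ ℤ.pos-* (suc n) _ ⟨
    + (suc n ℕ.* ((n C k) ℕ.* k !))        ≡⟨ cong +_ (ℕ.*-assoc (suc n) (n C k) (k !)) ⟨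
    + (suc n ℕ.* (n C k) ℕ.* k !)          ≡⟨ cong (λ x → + (x ℕ.* k !)) (C-absorb n k) ⟨
    + ((suc n C suc k) ℕ.* suc k ℕ.* k !)  ≡⟨ cong +_ (ℕ.*-assoc (suc n C suc k) (suc k) (k !)) ⟩
    + ((suc n C suc k) ℕ.* suc k !)        ∎

  choose : ℕ → ℤ → ℤ
  choose n (+ k)    = + (n C k)
  choose n -[1+ k ] = 0ℤ

  binom≡choose : ∀ n k → binom (+ n) k ≡ choose n k
  binom≡choose n -[1+ k ] = refl
  binom≡choose n (+ k)    = begin
    (falling (+ n) k ℤ./ℕ k !) {{k ℕ.!≢0}}
      ≡⟨ cong (λ x → (x ℤ./ℕ k !) {{k ℕ.!≢0}}) (falling≡C*! n k) ⟩
    + ((n C k) ℕ.* k ! ℕ./ k !) {{k ℕ.!≢0}}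
      ≡⟨ cong +_ (m*n/n≡m (n C k) (k !) {{k ℕ.!≢0}}) ⟩
    + (n C k) ∎

  choose-suc : ∀ n k → choose (suc n) k ≡ choose n (ℤ.pred k) + choose n k
  choose-suc n (+ zero)  = refl
  choose-suc n (+ suc k) = cong +_ (sym (pascal n k))
  choose-suc n -[1+ k ]  = refl

  choose-sym : ∀ n k → choose n k ≡ choose n (+ n - k)
  choose-sym n -[1+ k ] = sym (cong +_ (k>n⇒nCk≡0 (ℕ.m<m+n n (s≤s z≤n))))
  choose-sym n (+ k) with ℕ.≤-<-connex k n
  ... | Sum.inj₁ k≤n = begin
    + (n C k)             ≡⟨ cong +_ (nCk≡nC[n∸k] k≤n) ⟩
    + (n C (n ℕ.∸ k))     ≡⟨ cong (choose n) (ℤ.⊖-≥ k≤n) ⟨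
    choose n (n ℤ.⊖ k)    ≡⟨ cong (choose n) (ℤ.m-n≡m⊖n n k) ⟨
    choose n (+ n - + k)  ∎
  ... | Sum.inj₂ n<k@(s≤s {n = k-1} n≤k-1) = begin
    + (n C k)                        ≡⟨ cong +_ (k>n⇒nCk≡0 n<k) ⟩
    choose n (- + suc (k-1 ℕ.∸ n))   ≡⟨ cong (λ j → choose n (- + j)) (ℕ.+-∸-assoc 1 n≤k-1) ⟨
    choose n (- + (k ℕ.∸ n))         ≡⟨ cong (choose n) (ℤ.⊖-< n<k) ⟨
    choose n (n ℤ.⊖ k)               ≡⟨ cong (choose n) (ℤ.m-n≡m⊖n n k) ⟨
    choose n (+ n - + k)             ∎

  choose-reflect : ∀ n i {j} → + n - i ≡ j → choose n i ≡ choose n j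
  choose-reflect n i eq = trans (choose-sym n i) (cong (choose n) eq)

  choose-absorb : ∀ n k → (+ 1 + k) * choose n (+ 1 + k) + k * choose n k ≡ + n * choose n k
  choose-absorb n (+ k) = begin
    + suc k * + (n C suc k) + + k * + (n C k)
      ≡⟨ cong₂ _+_ (ℤ.*-comm (+ suc k) (+ (n C suc k))) (ℤ.*-comm (+ k) (+ (n C k))) ⟩
    + (n C suc k) * + suc k + + (n C k) * + k
      ≡⟨ cong₂ _+_ (ℤ.pos-* (n C suc k) (suc k)) (ℤ.pos-* (n C k) k) ⟨
    + ((n C suc k) ℕ.* suc k ℕ.+ (n C k) ℕ.* k)
      ≡⟨ cong +_ (C-absorb-sum n k) ⟩
    + (n ℕ.* (n C k))
      ≡⟨ ℤ.pos-* n (n C k) ⟩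
    + n * + (n C k) ∎
  choose-absorb n -[1+ zero ]  = sym (ℤ.*-zeroʳ (+ n))
  choose-absorb n -[1+ suc k ] = begin
    -[1+ k ] * 0ℤ + -[1+ suc k ] * 0ℤ  ≡⟨ cong₂ _+_ (ℤ.*-zeroʳ -[1+ k ]) (ℤ.*-zeroʳ -[1+ suc k ]) ⟩
    0ℤ                                 ≡⟨ ℤ.*-zeroʳ (+ n) ⟨
    + n * 0ℤ                           ∎

module ClosedForms where

  open import Data.Integer using (-[1+_]; _+_; _-_; -_)
  open Binomials
  import Data.Integer.Tactic.RingSolver as ℤ-Solver

  smooth : (ℤ → ℤ) → ℤ → ℤ
  smooth f t = f (ℤ.pred t) + + 2 * f t + f (ℤ.suc t)

  smooth-+ : ∀ f g t → smooth (λ s → f s + g s) t ≡ smooth f t + smooth g t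
  smooth-+ f g t = lemma (f (ℤ.pred t)) (f t) (f (ℤ.suc t)) (g (ℤ.pred t)) (g t) (g (ℤ.suc t))
    where
    lemma : ∀ a b c x y z → (a + x) + + 2 * (b + y) + (c + z) ≡ (a + + 2 * b + c) + (x + + 2 * y + z)
    lemma = ℤ-Solver.solve-∀

  smooth-- : ∀ f g t → smooth (λ s → f s - g s) t ≡ smooth f t - smooth g t
  smooth-- f g t = lemma (f (ℤ.pred t)) (f t) (f (ℤ.suc t)) (g (ℤ.pred t)) (g t) (g (ℤ.suc t))
    where
    lemma : ∀ a b c x y z → (a - x) + + 2 * (b - y) + (c - z) ≡ (a + + 2 * b + c) - (x + + 2 * y + z)
    lemma = ℤ-Solver.solve-∀

  smooth-* : ∀ c f t → smooth (λ s → c * f s) t ≡ c * smooth f t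
  smooth-* c f t = lemma c (f (ℤ.pred t)) (f t) (f (ℤ.suc t))
    where
    lemma : ∀ c x y z → c * x + + 2 * (c * y) + c * z ≡ c * (x + + 2 * y + z)
    lemma = ℤ-Solver.solve-∀

  choose-2+ : ∀ n k → choose (2 ℕ.+ n) k ≡ smooth (choose n) (ℤ.pred k)
  choose-2+ n k = begin
    choose (2 ℕ.+ n) k
      ≡⟨ choose-suc (suc n) k ⟩
    choose (suc n) (ℤ.pred k) + choose (suc n) k
      ≡⟨ cong₂ _+_ (choose-suc n (ℤ.pred k)) (choose-suc n k) ⟩
    (choose n (ℤ.pred (ℤ.pred k)) + choose n (ℤ.pred k)) + (choose n (ℤ.pred k) + choose n k)
      ≡⟨ lemma (choose n (ℤ.pred (ℤ.pred k))) (choose n (ℤ.pred k)) (choose n k) ⟩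
    choose n (ℤ.pred (ℤ.pred k)) + + 2 * choose n (ℤ.pred k) + choose n k
      ≡⟨ cong (λ i → choose n (ℤ.pred (ℤ.pred k)) + + 2 * choose n (ℤ.pred k) + choose n i) (i₀ k) ⟩
    smooth (choose n) (ℤ.pred k) ∎
    where
    lemma : ∀ a b c → (a + b) + (b + c) ≡ a + + 2 * b + c
    lemma = ℤ-Solver.solve-∀
    i₀ : ∀ k → k ≡ + 1 + (-[1+ 0 ] + k)
    i₀ = ℤ-Solver.solve-∀

  smooth-choose-asc : ∀ n c t → smooth (λ s → choose n (s - c)) t ≡ choose (2 ℕ.+ n) (ℤ.suc t - c)
  smooth-choose-asc n c t = sym (trans (choose-2+ n (ℤ.suc t - c))
    (cong₃ (λ x y z → choose n x + + 2 * choose n y + choose n z) (i₁ t c) (i₂ t c) (i₃ t c)))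
    where
    i₁ : ∀ t c → -[1+ 0 ] + (-[1+ 0 ] + (+ 1 + t - c)) ≡ -[1+ 0 ] + t - c
    i₁ = ℤ-Solver.solve-∀
    i₂ : ∀ t c → -[1+ 0 ] + (+ 1 + t - c) ≡ t - c
    i₂ = ℤ-Solver.solve-∀
    i₃ : ∀ t c → + 1 + (-[1+ 0 ] + (+ 1 + t - c)) ≡ + 1 + t - c
    i₃ = ℤ-Solver.solve-∀

  smooth-choose-desc : ∀ n c t → smooth (λ s → choose n (c - s)) t ≡ choose (2 ℕ.+ n) (ℤ.suc c - t)
  smooth-choose-desc n c t = sym (begin
    choose (2 ℕ.+ n) (ℤ.suc c - t)
      ≡⟨ choose-2+ n (ℤ.suc c - t) ⟩
    smooth (choose n) (ℤ.pred (ℤ.suc c - t))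
      ≡⟨ reverse (choose n (ℤ.pred (ℤ.pred (ℤ.suc c - t)))) (choose n (ℤ.pred (ℤ.suc c - t)))
                 (choose n (ℤ.suc (ℤ.pred (ℤ.suc c - t)))) ⟩
    choose n (ℤ.suc (ℤ.pred (ℤ.suc c - t))) + + 2 * choose n (ℤ.pred (ℤ.suc c - t))
      + choose n (ℤ.pred (ℤ.pred (ℤ.suc c - t)))
      ≡⟨ cong₃ (λ x y z → choose n x + + 2 * choose n y + choose n z) (i₁ c t) (i₂ c t) (i₃ c t) ⟩
    smooth (λ s → choose n (c - s)) t ∎)
    where
    reverse : ∀ a b c → a + + 2 * b + c ≡ c + + 2 * b + a
    reverse = ℤ-Solver.solve-∀
    i₁ : ∀ c t → + 1 + (-[1+ 0 ] + (+ 1 + c - t)) ≡ c - (-[1+ 0 ] + t)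
    i₁ = ℤ-Solver.solve-∀
    i₂ : ∀ c t → -[1+ 0 ] + (+ 1 + c - t) ≡ c - t
    i₂ = ℤ-Solver.solve-∀
    i₃ : ∀ c t → -[1+ 0 ] + (-[1+ 0 ] + (+ 1 + c - t)) ≡ c - (+ 1 + t)
    i₃ = ℤ-Solver.solve-∀

  oddExtension : (ℕ → ℕ) → ℤ → ℤ
  oddExtension f (+ t)    = + f t
  oddExtension f -[1+ t ] = - + f t

  smooth-oddExtension : ∀ {f g} → (∀ t → + f t ≡ g (+ t)) → g -[1+ 0 ] ≡ - g (+ 0) →
                        ∀ t → smooth (oddExtension f) (+ t) ≡ smooth g (+ t)
  smooth-oddExtension f≡g g-odd zero    =
    cong₃ (λ x y z → x + + 2 * y + z) (trans (cong -_ (f≡g 0)) (sym g-odd)) (f≡g 0) (f≡g 1)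
  smooth-oddExtension f≡g g-odd (suc t) =
    cong₃ (λ x y z → x + + 2 * y + z) (f≡g t) (f≡g (suc t)) (f≡g (2 ℕ.+ t))

  -- countFormula m and totalFormula m are denom n and numer n for n = 3 + m,
  -- as functions of an integer t.
  countFormula : ℕ → ℤ → ℤ
  countFormula m t = choose (2 ℕ.* (2 ℕ.+ m)) (+ (2 ℕ.+ m) - t)
                   - choose (2 ℕ.* (2 ℕ.+ m)) (+ (1 ℕ.+ m) - t)
                   + choose (1 ℕ.+ m) (t - + 2)

  totalFormula : ℕ → ℤ → ℤ
  totalFormula m t = choose (2 ℕ.* (1 ℕ.+ m)) (+ (2 ℕ.+ m) - t)
                   + + (1 ℕ.+ m) * choose (2 ℕ.* (1 ℕ.+ m)) (+ m - t)
                   - + (4 ℕ.+ m) * choose (2 ℕ.* (1 ℕ.+ m)) (ℤ.pred (+ m) - t)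
                   - choose m (t - + 2)

  smooth-countFormula : ∀ m t → smooth (countFormula m) t
    ≡ choose (2 ℕ.* (3 ℕ.+ m)) (+ (3 ℕ.+ m) - t) - choose (2 ℕ.* (3 ℕ.+ m)) (+ (2 ℕ.+ m) - t)
      + choose (3 ℕ.+ m) (ℤ.suc t - + 2)
  smooth-countFormula m t = begin
    smooth (countFormula m) t
      ≡⟨ smooth-+ (λ s → first s - second s) hook t ⟩
    smooth (λ s → first s - second s) t + smooth hook t
      ≡⟨ cong (_+ smooth hook t) (smooth-- first second t) ⟩
    smooth first t - smooth second t + smooth hook t
      ≡⟨ cong₃ (λ x y z → x - y + z) (smooth-choose-desc X (+ (2 ℕ.+ m)) t)
               (smooth-choose-desc X (+ (1 ℕ.+ m)) t) (smooth-choose-asc (1 ℕ.+ m) (+ 2) t) ⟩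
    choose (2 ℕ.+ X) (+ (3 ℕ.+ m) - t) - choose (2 ℕ.+ X) (+ (2 ℕ.+ m) - t)
      + choose (3 ℕ.+ m) (ℤ.suc t - + 2)
      ≡⟨ cong (λ N → choose N (+ (3 ℕ.+ m) - t) - choose N (+ (2 ℕ.+ m) - t) + choose (3 ℕ.+ m) (ℤ.suc t - + 2))
              (ℕ.*-suc 2 (2 ℕ.+ m)) ⟨
    choose (2 ℕ.* (3 ℕ.+ m)) (+ (3 ℕ.+ m) - t) - choose (2 ℕ.* (3 ℕ.+ m)) (+ (2 ℕ.+ m) - t)
      + choose (3 ℕ.+ m) (ℤ.suc t - + 2) ∎
    where
    X = 2 ℕ.* (2 ℕ.+ m)
    first second hook : ℤ → ℤ
    first s  = choose X (+ (2 ℕ.+ m) - s)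
    second s = choose X (+ (1 ℕ.+ m) - s)
    hook s   = choose (1 ℕ.+ m) (s - + 2)

  countFormula-smooth : ∀ m t →
    smooth (countFormula m) t ≡ countFormula (suc m) t + choose (2 ℕ.+ m) (ℤ.pred t)
  countFormula-smooth m t = begin
    smooth (countFormula m) t
      ≡⟨ smooth-countFormula m t ⟩
    a - b + choose (3 ℕ.+ m) (ℤ.suc t - + 2)
      ≡⟨ cong (λ h → a - b + h) (choose-suc (2 ℕ.+ m) (ℤ.suc t - + 2)) ⟩
    a - b + (choose (2 ℕ.+ m) (ℤ.pred (ℤ.suc t - + 2)) + choose (2 ℕ.+ m) (ℤ.suc t - + 2))
      ≡⟨ cong₂ (λ x y → a - b + (choose (2 ℕ.+ m) x + choose (2 ℕ.+ m) y)) (i₁ t) (i₂ t) ⟩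
    a - b + (choose (2 ℕ.+ m) (t - + 2) + choose (2 ℕ.+ m) (ℤ.pred t))
      ≡⟨ ℤ.+-assoc (a - b) (choose (2 ℕ.+ m) (t - + 2)) (choose (2 ℕ.+ m) (ℤ.pred t)) ⟨
    countFormula (suc m) t + choose (2 ℕ.+ m) (ℤ.pred t) ∎
    where
    a = choose (2 ℕ.* (3 ℕ.+ m)) (+ (3 ℕ.+ m) - t)
    b = choose (2 ℕ.* (3 ℕ.+ m)) (+ (2 ℕ.+ m) - t)
    i₁ : ∀ t → -[1+ 0 ] + (+ 1 + t - + 2) ≡ t - + 2
    i₁ = ℤ-Solver.solve-∀
    i₂ : ∀ t → + 1 + t - + 2 ≡ -[1+ 0 ] + t
    i₂ = ℤ-Solver.solve-∀

  smooth-totalFormula : ∀ m t → smooth (totalFormula m) t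
    ≡ choose (2 ℕ.* (2 ℕ.+ m)) (+ (3 ℕ.+ m) - t)
      + + (1 ℕ.+ m) * choose (2 ℕ.* (2 ℕ.+ m)) (+ (1 ℕ.+ m) - t)
      - + (4 ℕ.+ m) * choose (2 ℕ.* (2 ℕ.+ m)) (+ m - t)
      - choose (2 ℕ.+ m) (ℤ.suc t - + 2)
  smooth-totalFormula m t = begin
    smooth (totalFormula m) t
      ≡⟨ smooth-- (λ s → first s + p * second s - q * third s) hook t ⟩
    smooth (λ s → first s + p * second s - q * third s) t - smooth hook t
      ≡⟨ cong (_- smooth hook t) (smooth-- (λ s → first s + p * second s) (λ s → q * third s) t) ⟩
    smooth (λ s → first s + p * second s) t - smooth (λ s → q * third s) t - smooth hook t
      ≡⟨ cong₂ (λ x y → x - y - smooth hook t)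
               (trans (smooth-+ first (λ s → p * second s) t)
                      (cong (λ x → smooth first t + x) (smooth-* p second t)))
               (smooth-* q third t) ⟩
    smooth first t + p * smooth second t - q * smooth third t - smooth hook t
      ≡⟨ cong₂ (λ x y → x - y)
           (cong₃ (λ x y z → x + p * y - q * z) (smooth-choose-desc M (+ (2 ℕ.+ m)) t)
                  (smooth-choose-desc M (+ m) t) (smooth-choose-desc M (ℤ.pred (+ m)) t))
           (smooth-choose-asc m (+ 2) t) ⟩
    choose (2 ℕ.+ M) (+ (3 ℕ.+ m) - t) + p * choose (2 ℕ.+ M) (+ (1 ℕ.+ m) - t)
      - q * choose (2 ℕ.+ M) (ℤ.suc (ℤ.pred (+ m)) - t) - choose (2 ℕ.+ m) (ℤ.suc t - + 2)
      ≡⟨ cong₂ (λ N z → choose N (+ (3 ℕ.+ m) - t) + p * choose N (+ (1 ℕ.+ m) - t)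
                       - q * choose N z - choose (2 ℕ.+ m) (ℤ.suc t - + 2))
               (sym (ℕ.*-suc 2 (1 ℕ.+ m))) (i₀ (+ m) t) ⟩
    choose X (+ (3 ℕ.+ m) - t) + p * choose X (+ (1 ℕ.+ m) - t)
      - q * choose X (+ m - t) - choose (2 ℕ.+ m) (ℤ.suc t - + 2) ∎
    where
    M = 2 ℕ.* (1 ℕ.+ m)
    X = 2 ℕ.* (2 ℕ.+ m)
    p = + (1 ℕ.+ m)
    q = + (4 ℕ.+ m)
    first second third hook : ℤ → ℤ
    first s  = choose M (+ (2 ℕ.+ m) - s)
    second s = choose M (+ m - s)
    third s  = choose M (ℤ.pred (+ m) - s)
    hook s   = choose m (s - + 2)
    i₀ : ∀ m t → + 1 + (-[1+ 0 ] + m) - t ≡ m - t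
    i₀ = ℤ-Solver.solve-∀

  totalFormula-smooth : ∀ m t → smooth (totalFormula m) t + countFormula m (ℤ.suc t) ≡ totalFormula (suc m) t
  totalFormula-smooth m t = begin
    smooth (totalFormula m) t + countFormula m (ℤ.suc t)
      ≡⟨ cong₂ _+_ (smooth-totalFormula m t)
               (cong₂ (λ x y → choose X x - choose X y + h)
                      (i₁ (+ (2 ℕ.+ m)) t) (i₁ (+ (1 ℕ.+ m)) t)) ⟩
    a + + (1 ℕ.+ m) * b - + (4 ℕ.+ m) * c - choose (2 ℕ.+ m) (ℤ.suc t - + 2) + (b - c + h)
      ≡⟨ cong (λ x → a + + (1 ℕ.+ m) * b - + (4 ℕ.+ m) * c - x + (b - c + h))
              (trans (choose-suc (1 ℕ.+ m) (ℤ.suc t - + 2))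
                     (cong (λ i → choose (1 ℕ.+ m) i + h) (i₂ t))) ⟩
    a + + (1 ℕ.+ m) * b - + (4 ℕ.+ m) * c - (h′ + h) + (b - c + h)
      ≡⟨ collect (+ m) a b c h h′ ⟩
    totalFormula (suc m) t ∎
    where
    X  = 2 ℕ.* (2 ℕ.+ m)
    a  = choose X (+ (3 ℕ.+ m) - t)
    b  = choose X (+ (1 ℕ.+ m) - t)
    c  = choose X (+ m - t)
    h  = choose (1 ℕ.+ m) (ℤ.suc t - + 2)
    h′ = choose (1 ℕ.+ m) (t - + 2)
    i₁ : ∀ c t → c - (+ 1 + t) ≡ -[1+ 0 ] + c - t
    i₁ = ℤ-Solver.solve-∀
    i₂ : ∀ t → -[1+ 0 ] + (+ 1 + t - + 2) ≡ t - + 2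
    i₂ = ℤ-Solver.solve-∀
    collect : ∀ m a b c h h′ → a + (+ 1 + m) * b - (+ 4 + m) * c - (h′ + h) + (b - c + h)
                             ≡ a + (+ 2 + m) * b - (+ 5 + m) * c - h′
    collect = ℤ-Solver.solve-∀

  countFormula-odd : ∀ m → countFormula m -[1+ 0 ] ≡ - countFormula m (+ 0)
  countFormula-odd m = begin
    choose X (+ (2 ℕ.+ m) - -[1+ 0 ]) - choose X (+ (1 ℕ.+ m) - -[1+ 0 ]) + 0ℤ
      ≡⟨ cong₂ (λ x y → x - y + 0ℤ) (choose-reflect X (+ (2 ℕ.+ m) - -[1+ 0 ]) (i₁ (+ m)))
                                    (choose-reflect X (+ (1 ℕ.+ m) - -[1+ 0 ]) (i₂ (+ m))) ⟩
    choose X (+ (1 ℕ.+ m) - + 0) - choose X (+ (2 ℕ.+ m) - + 0) + 0ℤ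
      ≡⟨ negate (choose X (+ (1 ℕ.+ m) - + 0)) (choose X (+ (2 ℕ.+ m) - + 0)) ⟩
    - (choose X (+ (2 ℕ.+ m) - + 0) - choose X (+ (1 ℕ.+ m) - + 0) + 0ℤ) ∎
    where
    X = 2 ℕ.* (2 ℕ.+ m)
    i₁ : ∀ m → + 2 * (+ 2 + m) - (+ 2 + m - -[1+ 0 ]) ≡ + 1 + m - + 0
    i₁ = ℤ-Solver.solve-∀
    i₂ : ∀ m → + 2 * (+ 2 + m) - (+ 1 + m - -[1+ 0 ]) ≡ + 2 + m - + 0
    i₂ = ℤ-Solver.solve-∀
    negate : ∀ x y → x - y + 0ℤ ≡ - (y - x + 0ℤ)
    negate = ℤ-Solver.solve-∀

  -- The sum of both sides is (1+m) a - 2 b - (3+m) c for a, b, c = C(M, m+1),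
  -- C(M, m), C(M, m-1): the sum of the absorption identities at k = m, m - 1.
  totalFormula-odd : ∀ m → totalFormula m -[1+ 0 ] ≡ - totalFormula m (+ 0)
  totalFormula-odd m = begin
    totalFormula m -[1+ 0 ]
      ≡⟨ cong₃ (λ x y z → x + + (1 ℕ.+ m) * y - + (4 ℕ.+ m) * z - 0ℤ)
               (choose-reflect M (+ (2 ℕ.+ m) - -[1+ 0 ]) (i₁ (+ m)))
               (cong (choose M) (i₂ (+ m))) (cong (choose M) (i₃ (+ m))) ⟩
    c + + (1 ℕ.+ m) * a - + (4 ℕ.+ m) * b - 0ℤ
      ≡⟨ split (+ m) a b c ⟩
    - (b + + (1 ℕ.+ m) * b - + (4 ℕ.+ m) * c - 0ℤ) + (absorbed₁ - + M * b) + (absorbed₂ - + M * c)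
      ≡⟨ cong₂ (λ x y → - (b + + (1 ℕ.+ m) * b - + (4 ℕ.+ m) * c - 0ℤ) + x + y)
               (ℤ.i≡j⇒i-j≡0 (choose-absorb M (+ m))) (ℤ.i≡j⇒i-j≡0 absorbed₂≡) ⟩
    - (b + + (1 ℕ.+ m) * b - + (4 ℕ.+ m) * c - 0ℤ) + 0ℤ + 0ℤ
      ≡⟨ trans (ℤ.+-identityʳ _) (ℤ.+-identityʳ _) ⟩
    - (b + + (1 ℕ.+ m) * b - + (4 ℕ.+ m) * c - 0ℤ)
      ≡⟨ cong₃ (λ x y z → - (x + + (1 ℕ.+ m) * y - + (4 ℕ.+ m) * z - 0ℤ))
               (choose-reflect M (+ (2 ℕ.+ m) - + 0) (i₄ (+ m)))
               (cong (choose M) (i₅ (+ m))) (cong (choose M) (i₅ (ℤ.pred (+ m)))) ⟨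
    - totalFormula m (+ 0) ∎
    where
    M = 2 ℕ.* (1 ℕ.+ m)
    a = choose M (+ 1 + + m)
    b = choose M (+ m)
    c = choose M (ℤ.pred (+ m))
    absorbed₁ = (+ 1 + + m) * a + + m * b
    absorbed₂ = + m * b + ℤ.pred (+ m) * c
    i₁ : ∀ m → + 2 * (+ 1 + m) - (+ 2 + m - -[1+ 0 ]) ≡ -[1+ 0 ] + m
    i₁ = ℤ-Solver.solve-∀
    i₂ : ∀ m → m - -[1+ 0 ] ≡ + 1 + m
    i₂ = ℤ-Solver.solve-∀
    i₃ : ∀ m → -[1+ 0 ] + m - -[1+ 0 ] ≡ m
    i₃ = ℤ-Solver.solve-∀
    i₄ : ∀ m → + 2 * (+ 1 + m) - (+ 2 + m - + 0) ≡ m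
    i₄ = ℤ-Solver.solve-∀
    i₅ : ∀ m → m - + 0 ≡ m
    i₅ = ℤ-Solver.solve-∀
    i₆ : ∀ m → m ≡ + 1 + (-[1+ 0 ] + m)
    i₆ = ℤ-Solver.solve-∀
    absorbed₂≡ : absorbed₂ ≡ + M * c
    absorbed₂≡ = trans (cong (λ k → k * choose M k + ℤ.pred (+ m) * c) (i₆ (+ m)))
                       (choose-absorb M (ℤ.pred (+ m)))
    split : ∀ m a b c → c + (+ 1 + m) * a - (+ 4 + m) * b - 0ℤ
                      ≡ - (b + (+ 1 + m) * b - (+ 4 + m) * c - 0ℤ)
                        + ((+ 1 + m) * a + m * b - + 2 * (+ 1 + m) * b)
                        + (m * b + (-[1+ 0 ] + m) * c - + 2 * (+ 1 + m) * c)
    split = ℤ-Solver.solve-∀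

  denom≡countFormula : ∀ m t → denom (3 ℕ.+ m) t ≡ countFormula m (+ t)
  denom≡countFormula m t =
    cong₃ (λ x y z → x - y + z) (term (i₁ (+ m) (+ t))) (term (i₂ (+ m) (+ t)))
          (binom≡choose (1 ℕ.+ m) (+ t - + 2))
    where
    X = 2 ℕ.* (2 ℕ.+ m)
    i₀ : ∀ m → + 2 * (+ 3 + m) - + 2 ≡ + 2 * (+ 2 + m)
    i₀ = ℤ-Solver.solve-∀
    term : ∀ {k k′} → k ≡ k′ → binom (+ (2 ℕ.* (3 ℕ.+ m)) - + 2) k ≡ choose X k′
    term {k′ = k′} k≡k′ = trans (cong₂ binom (i₀ (+ m)) k≡k′) (binom≡choose X k′)
    i₁ : ∀ m t → + 3 + m - t - + 1 ≡ + 2 + m - t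
    i₁ = ℤ-Solver.solve-∀
    i₂ : ∀ m t → + 3 + m - t - + 2 ≡ + 1 + m - t
    i₂ = ℤ-Solver.solve-∀

  numer≡totalFormula : ∀ m t → numer (3 ℕ.+ m) t ≡ totalFormula m (+ t)
  numer≡totalFormula m t =
    cong₂ _-_
      (cong₂ _-_ (cong₂ _+_ (term (i₁ (+ m) (+ t))) (cong₂ _*_ (i₄ (+ m)) (term (i₂ (+ m) (+ t)))))
                 (cong₂ _*_ (i₅ (+ m)) (term (i₃ (+ m) (+ t)))))
      (binom≡choose m (+ t - + 2))
    where
    M = 2 ℕ.* (1 ℕ.+ m)
    i₀ : ∀ m → + 2 * (+ 3 + m) - + 4 ≡ + 2 * (+ 1 + m)
    i₀ = ℤ-Solver.solve-∀
    term : ∀ {k k′} → k ≡ k′ → binom (+ (2 ℕ.* (3 ℕ.+ m)) - + 4) k ≡ choose M k′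
    term {k′ = k′} k≡k′ = trans (cong₂ binom (i₀ (+ m)) k≡k′) (binom≡choose M k′)
    i₁ : ∀ m t → + 3 + m - t - + 1 ≡ + 2 + m - t
    i₁ = ℤ-Solver.solve-∀
    i₂ : ∀ m t → + 3 + m - t - + 3 ≡ m - t
    i₂ = ℤ-Solver.solve-∀
    i₃ : ∀ m t → + 3 + m - t - + 4 ≡ -[1+ 0 ] + m - t
    i₃ = ℤ-Solver.solve-∀
    i₄ : ∀ m → + 3 + m - + 2 ≡ + 1 + m
    i₄ = ℤ-Solver.solve-∀
    i₅ : ∀ m → + 3 + m + + 1 ≡ + 4 + m
    i₅ = ℤ-Solver.solve-∀

module Words where

  open import Data.Nat using (_+_; _<_)
  open import Data.Fin as Fin using (zero; suc)
  import Data.Fin.Properties as Fin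
  open import Data.Vec using (Vec; []; _∷_; lookup)
  open import Data.Product using (∃)
  open import Data.Empty using (⊥-elim; ⊥-elim-irr)
  open import Data.Irrelevant using (Irrelevant; [_])
  open import Function using (case_of_)
  open import Function.Bundles using (mk↔ₛ′)
  open import Relation.Nullary using (¬_; Dec; yes; no)

  private variable n e t : ℕ

  data Site : Set where
    upper lower : ℕ → Site

  upper-injective : ∀ {i j} → upper i ≡ upper j → i ≡ j
  upper-injective refl = refl

  lower-injective : ∀ {i j} → lower i ≡ lower j → i ≡ j
  lower-injective refl = refl

  _≟ˢ_ : (s s′ : Site) → Dec (s ≡ s′)
  upper i ≟ˢ upper j with i ℕ.≟ j
  ... | yes refl = yes refl
  ... | no i≢j   = no λ eq → i≢j (upper-injective eq)
  upper i ≟ˢ lower j = no λ ()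
  lower i ≟ˢ upper j = no λ ()
  lower i ≟ˢ lower j with i ℕ.≟ j
  ... | yes refl = yes refl
  ... | no i≢j   = no λ eq → i≢j (lower-injective eq)

  siteRow : Site → ℕ
  siteRow (upper _) = 1
  siteRow (lower _) = 2

  siteCol : Site → ℕ
  siteCol (upper j) = j
  siteCol (lower j) = j

  _≼_ : Site → Site → Set
  s ≼ s′ = siteRow s ≤ siteRow s′ × siteCol s ≤ siteCol s′

  Inside : ℕ → ℕ → Site → Set
  Inside a b (upper j) = j < a
  Inside a b (lower j) = j < b

  Occurs : Site → Vec Site n → Set
  Occurs s v = ∃ λ i → lookup v i ≡ s

  -- Entry 0 of the word is the site of the largest number, so weakly south-east
  -- sites carry smaller indices.
  record IsReversedTableau (a b : ℕ) {n} (v : Vec Site n) : Set where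
    field
      inside     : ∀ i → Inside a b (lookup v i)
      onto       : ∀ s → Inside a b s → Occurs s v
      decreasing : ∀ i j → lookup v i ≢ lookup v j → lookup v i ≼ lookup v j → j Fin.< i
  open IsReversedTableau

  -- Growth n e t: the ways of placing 1, …, n one at a time, each new number
  -- joining the last cell of a row or opening a new cell at its end, so that
  -- the final shape is (e + t, e).
  data Growth : ℕ → ℕ → ℕ → Set where
    start   : Growth 0 0 0
    joinTop : Growth n e (suc t) → Growth (suc n) e (suc t)
    openTop : Growth n e t → Growth (suc n) e (suc t)
    joinBot : Growth n (suc e) t → Growth (suc n) (suc e) t
    openBot : Growth n e (suc t) → Growth (suc n) (suc e) t

  sites : Growth n e t → Vec Site n
  sites start                       = []
  sites (joinTop {e = e} {t = t} g) = upper (e + t) ∷ sites g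
  sites (openTop {e = e} {t = t} g) = upper (e + t) ∷ sites g
  sites (joinBot {e = e} g)         = lower e ∷ sites g
  sites (openBot {e = e} g)         = lower e ∷ sites g

  upper-inside : ∀ e t → Inside (e + suc t) e (upper (e + t))
  upper-inside e t = subst (e + t <_) (sym (ℕ.+-suc e t)) ℕ.≤-refl

  Maximal : ℕ → ℕ → Site → Set
  Maximal a b s = ∀ s′ → Inside a b s′ → s ≢ s′ → ¬ (s ≼ s′)

  inside-mono : ∀ {a b a′ b′} → a ≤ a′ → b ≤ b′ → ∀ s → Inside a b s → Inside a′ b′ s
  inside-mono a≤a′ b≤b′ (upper j) j<a = ℕ.<-≤-trans j<a a≤a′
  inside-mono a≤a′ b≤b′ (lower j) j<b = ℕ.<-≤-trans j<b b≤b′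

  upper-maximal : ∀ {a b k} → b ≤ k → a ≤ suc k → Maximal a b (upper k)
  upper-maximal b≤k a≤1+k (upper j) j<a ne (_ , k≤j) =
    ne (cong upper (ℕ.≤-antisym k≤j (ℕ.≤-pred (ℕ.≤-trans j<a a≤1+k))))
  upper-maximal b≤k a≤1+k (lower j) j<b ne (_ , k≤j) = ℕ.<⇒≱ j<b (ℕ.≤-trans b≤k k≤j)

  lower-maximal : ∀ {a b k} → b ≤ suc k → Maximal a b (lower k)
  lower-maximal b≤1+k (upper j) j<a ne (s≤s () , _)
  lower-maximal b≤1+k (lower j) j<b ne (_ , k≤j) =
    ne (cong lower (ℕ.≤-antisym k≤j (ℕ.≤-pred (ℕ.≤-trans j<b b≤1+k))))

  shrinkTop : ∀ e t s → Inside (e + suc t) e s → upper (e + t) ≢ s → Inside (e + t) e s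
  shrinkTop e t (upper j) j<a ne =
    ℕ.≤∧≢⇒< (ℕ.≤-pred (subst (j <_) (ℕ.+-suc e t) j<a)) (λ j≡ → ne (cong upper (sym j≡)))
  shrinkTop e t (lower j) j<b ne = j<b

  shrinkBot : ∀ e t s → Inside (suc e + t) (suc e) s → lower e ≢ s → Inside (e + suc t) e s
  shrinkBot e t (upper j) j<a ne = subst (j <_) (sym (ℕ.+-suc e t)) j<a
  shrinkBot e t (lower j) j<b ne = ℕ.≤∧≢⇒< (ℕ.≤-pred j<b) (λ j≡ → ne (cong lower (sym j≡)))

  ∷-isReversedTableau : ∀ {a b a′ b′} {v : Vec Site n} (s : Site) → IsReversedTableau a′ b′ v →
    a′ ≤ a → b′ ≤ b → Inside a b s → Maximal a′ b′ s →
    (∀ s′ → Inside a b s′ → s ≢ s′ → Inside a′ b′ s′) → IsReversedTableau a b (s ∷ v)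
  ∷-isReversedTableau s p a′≤a b′≤b s-in s-max shrink = record
    { inside     = λ { zero → s-in ; (suc i) → inside-mono a′≤a b′≤b _ (inside p i) }
    ; onto       = onto′
    ; decreasing = decreasing′
    }
    where
    onto′ : ∀ s′ → Inside _ _ s′ → Occurs s′ (s ∷ _)
    onto′ s′ s′-in with s ≟ˢ s′
    ... | yes s≡s′ = zero , s≡s′
    ... | no s≢s′  = let i , eq = onto p s′ (shrink s′ s′-in s≢s′) in suc i , eq
    decreasing′ : ∀ i j → lookup (s ∷ _) i ≢ lookup (s ∷ _) j →
                  lookup (s ∷ _) i ≼ lookup (s ∷ _) j → j Fin.< i
    decreasing′ zero    zero    ne _ = ⊥-elim (ne refl)
    decreasing′ zero    (suc j) ne le = ⊥-elim (s-max _ (inside p j) ne le)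
    decreasing′ (suc i) zero    _ _ = s≤s z≤n
    decreasing′ (suc i) (suc j) ne le = s≤s (decreasing p i j ne le)

  sites-isReversedTableau : (g : Growth n e t) → IsReversedTableau (e + t) e (sites g)
  sites-isReversedTableau start = record
    { inside = λ () ; onto = λ { (upper _) () ; (lower _) () } ; decreasing = λ () }
  sites-isReversedTableau (joinTop {e = e} {t = t} g) =
    ∷-isReversedTableau _ (sites-isReversedTableau g) ℕ.≤-refl ℕ.≤-refl
      (upper-inside e t) (upper-maximal (ℕ.m≤m+n e t) (ℕ.≤-reflexive (ℕ.+-suc e t)))
      (λ _ s′-in _ → s′-in)
  sites-isReversedTableau (openTop {e = e} {t = t} g) =
    ∷-isReversedTableau _ (sites-isReversedTableau g) (ℕ.+-monoʳ-≤ e (ℕ.n≤1+n t)) ℕ.≤-refl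
      (upper-inside e t) (upper-maximal (ℕ.m≤m+n e t) (ℕ.n≤1+n _))
      (shrinkTop e t)
  sites-isReversedTableau (joinBot g) =
    ∷-isReversedTableau _ (sites-isReversedTableau g) ℕ.≤-refl ℕ.≤-refl
      ℕ.≤-refl (lower-maximal ℕ.≤-refl) (λ _ s′-in _ → s′-in)
  sites-isReversedTableau (openBot {e = e} {t = t} g) =
    ∷-isReversedTableau _ (sites-isReversedTableau g) (ℕ.≤-reflexive (ℕ.+-suc e t)) (ℕ.n≤1+n e)
      ℕ.≤-refl (lower-maximal (ℕ.n≤1+n e)) (shrinkBot e t)

  module _ {a b s} {v : Vec Site n} (p : IsReversedTableau a b (s ∷ v)) where

    head-maximal : Maximal a b s
    head-maximal s′ s′-in ne le with onto p s′ s′-in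
    ... | zero  , eq   = ne eq
    ... | suc j , refl with decreasing p zero (suc j) ne le
    ...   | ()

    tail-same : Occurs s v → IsReversedTableau a b v
    tail-same (j₀ , eq₀) = record
      { inside     = λ j → inside p (suc j)
      ; onto       = λ s′ s′-in → case onto p s′ s′-in of λ
                       { (zero , eq) → j₀ , trans eq₀ eq ; (suc j , eq) → j , eq }
      ; decreasing = λ i j ne le → ℕ.≤-pred (decreasing p (suc i) (suc j) ne le)
      }

    tail-shrink : ∀ {a′ b′} → ¬ Occurs s v →
      (∀ s′ → Inside a b s′ → s ≢ s′ → Inside a′ b′ s′) →
      (∀ s′ → Inside a′ b′ s′ → Inside a b s′) →
      ¬ Inside a′ b′ s → IsReversedTableau a′ b′ v
    tail-shrink s∉v shrink grow s-out = record
      { inside     = λ j → shrink _ (inside p (suc j)) (λ eq → s∉v (j , sym eq))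
      ; onto       = λ s′ s′-in → case onto p s′ (grow s′ s′-in) of λ
                       { (zero , refl) → ⊥-elim (s-out s′-in) ; (suc j , eq) → j , eq }
      ; decreasing = λ i j ne le → ℕ.≤-pred (decreasing p (suc i) (suc j) ne le)
      }

  growTop : ∀ e t s → Inside (e + t) e s → Inside (e + suc t) e s
  growTop e t = inside-mono (ℕ.+-monoʳ-≤ e (ℕ.n≤1+n t)) ℕ.≤-refl

  growBot : ∀ e t s → Inside (e + suc t) e s → Inside (suc e + t) (suc e) s
  growBot e t = inside-mono (ℕ.≤-reflexive (ℕ.+-suc e t)) (ℕ.n≤1+n e)

  data Corner : ℕ → ℕ → Site → Set where
    upperCorner : Corner e (suc t) (upper (e + t))
    lowerCorner : Corner (suc e) t (lower e)

  corner : ∀ s {v : Vec Site n} → .(IsReversedTableau (e + t) e (s ∷ v)) → Corner e t s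
  corner {e = e} {t = zero} (upper k) p =
    ⊥-elim-irr (head-maximal p (lower k) (subst (k <_) (ℕ.+-identityʳ e) (inside p zero))
                             (λ ()) (s≤s z≤n , ℕ.≤-refl))
  corner {e = e} {t = suc t} (upper k) p with k ℕ.≟ e + t
  ... | yes refl = upperCorner
  ... | no k≢e+t = ⊥-elim-irr (head-maximal p (upper (suc k)) (next-inside (inside p zero))
                                 (λ eq → ℕ.1+n≢n (sym (upper-injective eq))) (ℕ.≤-refl , ℕ.n≤1+n k))
    where
    next-inside : k < e + suc t → suc k < e + suc t
    next-inside k< = subst (suc k <_) (sym (ℕ.+-suc e t))
                       (s≤s (ℕ.≤∧≢⇒< (ℕ.≤-pred (subst (k <_) (ℕ.+-suc e t) k<)) k≢e+t))
  corner {e = zero} (lower k) p = ⊥-elim-irr (ℕ.n≮0 (inside p zero))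
  corner {e = suc e} (lower k) p with k ℕ.≟ e
  ... | yes refl = lowerCorner
  ... | no k≢e = ⊥-elim-irr (head-maximal p (lower (suc k)) (s≤s (ℕ.≤∧≢⇒< (ℕ.≤-pred (inside p zero)) k≢e))
                               (λ eq → ℕ.1+n≢n (sym (lower-injective eq))) (ℕ.≤-refl , ℕ.n≤1+n k))

  upper-outside : ∀ e t → ¬ Inside (e + t) e (upper (e + t))
  upper-outside e t = ℕ.n≮n (e + t)

  lower-outside : ∀ e t → ¬ Inside (e + suc t) e (lower e)
  lower-outside e t = ℕ.n≮n e

  tail-openTop : ∀ {e t} {v : Vec Site n} → IsReversedTableau (e + suc t) e (upper (e + t) ∷ v) →
                 ¬ Occurs (upper (e + t)) v → IsReversedTableau (e + t) e v
  tail-openTop {e = e} {t} p s∉v = tail-shrink p s∉v (shrinkTop e t) (growTop e t) (upper-outside e t)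

  tail-openBot : ∀ {e t} {v : Vec Site n} → IsReversedTableau (suc e + t) (suc e) (lower e ∷ v) →
                 ¬ Occurs (lower e) v → IsReversedTableau (e + suc t) e v
  tail-openBot {e = e} {t} p s∉v = tail-shrink p s∉v (shrinkBot e t) (growBot e t) (lower-outside e t)

  empty-word : ∀ {a b} → ¬ IsReversedTableau (suc a) b []
  empty-word p with onto p (upper 0) (s≤s z≤n)
  ... | () , _

  occurs? : ∀ s (v : Vec Site n) → Dec (Occurs s v)
  occurs? s v = Fin.any? (λ j → lookup v j ≟ˢ s)

  fromSites : (v : Vec Site n) (e t : ℕ) → .(IsReversedTableau (e + t) e v) → Growth n e t
  fromSites []      zero    zero    p = start
  fromSites []      zero    (suc t) p = ⊥-elim-irr (empty-word p)
  fromSites []      (suc e) t       p = ⊥-elim-irr (empty-word p)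
  fromSites (s ∷ v) e       t       p with corner s p
  ... | upperCorner {t = t′} with occurs? (upper (e + t′)) v
  ...   | yes s∈v = joinTop (fromSites v e (suc t′) (tail-same p s∈v))
  ...   | no  s∉v = openTop (fromSites v e t′ (tail-openTop p s∉v))
  fromSites (s ∷ v) e       t       p | lowerCorner {e = e′} with occurs? (lower e′) v
  ...   | yes s∈v = joinBot (fromSites v e t (tail-same p s∈v))
  ...   | no  s∉v = openBot (fromSites v e′ (suc t) (tail-openBot p s∉v))

  sites-fromSites : (v : Vec Site n) (e t : ℕ) .(p : IsReversedTableau (e + t) e v) →
                    sites (fromSites v e t p) ≡ v
  sites-fromSites []      zero    zero    p = refl
  sites-fromSites []      zero    (suc t) p = ⊥-elim-irr (empty-word p)
  sites-fromSites []      (suc e) t       p = ⊥-elim-irr (empty-word p)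
  sites-fromSites (s ∷ v) e       t       p with corner s p
  ... | upperCorner {t = t′} with occurs? (upper (e + t′)) v
  ...   | yes s∈v = cong (s ∷_) (sites-fromSites v e (suc t′) (tail-same p s∈v))
  ...   | no  s∉v = cong (s ∷_) (sites-fromSites v e t′ (tail-openTop p s∉v))
  sites-fromSites (s ∷ v) e       t       p | lowerCorner {e = e′} with occurs? (lower e′) v
  ...   | yes s∈v = cong (s ∷_) (sites-fromSites v e t (tail-same p s∈v))
  ...   | no  s∉v = cong (s ∷_) (sites-fromSites v e′ (suc t) (tail-openBot p s∉v))

  fromSites-sites : (g : Growth n e t) .(p : IsReversedTableau (e + t) e (sites g)) →
                    fromSites (sites g) e t p ≡ g
  fromSites-sites start p = refl
  fromSites-sites (joinTop {e = e} {t = t} g) p with corner (upper (e + t)) p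
  ... | upperCorner with occurs? (upper (e + t)) (sites g)
  ...   | yes _   = cong joinTop (fromSites-sites g (sites-isReversedTableau g))
  ...   | no  s∉g = ⊥-elim (s∉g (onto (sites-isReversedTableau g) (upper (e + t)) (upper-inside e t)))
  fromSites-sites (openTop {e = e} {t = t} g) p with corner (upper (e + t)) p
  ... | upperCorner with occurs? (upper (e + t)) (sites g)
  ...   | yes (j , eq) =
    ⊥-elim (upper-outside e t (subst (Inside (e + t) e) eq (inside (sites-isReversedTableau g) j)))
  ...   | no  _        = cong openTop (fromSites-sites g (sites-isReversedTableau g))
  fromSites-sites (joinBot {e = e} g) p with corner (lower e) p
  ... | lowerCorner with occurs? (lower e) (sites g)
  ...   | yes _   = cong joinBot (fromSites-sites g (sites-isReversedTableau g))
  ...   | no  s∉g = ⊥-elim (s∉g (onto (sites-isReversedTableau g) (lower e) ℕ.≤-refl))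
  fromSites-sites (openBot {e = e} {t = t} g) p with corner (lower e) p
  ... | lowerCorner with occurs? (lower e) (sites g)
  ...   | yes (j , eq) =
    ⊥-elim (lower-outside e t (subst (Inside (e + suc t) e) eq (inside (sites-isReversedTableau g) j)))
  ...   | no  _        = cong openBot (fromSites-sites g (sites-isReversedTableau g))

  Growths TallGrowths : ℕ → ℕ → Set
  Growths n t     = Σ ℕ λ e → Growth n e t
  TallGrowths n t = Σ ℕ λ e → Growth n (suc e) t

  ReversedTableaux : ℕ → ℕ → ℕ → Set
  ReversedTableaux n a b = Σ (Vec Site n) (λ v → Irrelevant (IsReversedTableau a b v))

  ReversedTableaux-≡ : ∀ {a b} {v v′ : Vec Site n} {p : Irrelevant (IsReversedTableau a b v)}
                       {p′ : Irrelevant (IsReversedTableau a b v′)} → v ≡ v′ → (v , p) ≡ (v′ , p′)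
  ReversedTableaux-≡ refl = refl

  Growth↔ReversedTableaux : ∀ e t → Growth n e t ↔ ReversedTableaux n (e + t) e
  Growth↔ReversedTableaux e t = mk↔ₛ′
    (λ g → sites g , [ sites-isReversedTableau g ])
    (λ { (v , [ p ]) → fromSites v e t p })
    (λ { (v , [ p ]) → ReversedTableaux-≡ (sites-fromSites v e t p) })
    (λ g → fromSites-sites g (sites-isReversedTableau g))

module Fillings where

  open Words
  open import Data.Fin as Fin using (toℕ; fromℕ<; opposite)
  import Data.Fin.Properties as Fin
  open import Data.Vec using (Vec; lookup; tabulate)
  import Data.Vec.Properties as Vec
  open import Data.Product using (∃)
  open import Data.Irrelevant using ([_])
  open import Function using (_∘_)
  open import Function.Bundles using (mk↔ₛ′)
  open import Function.Properties.Inverse using (↔-sym; ↔-trans)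
  open import Data.Product.Function.Dependent.Propositional using (congˡ)
  open IsReversedTableau

  opposite-cancel-< : ∀ {n} (i j : Fin n) → opposite i Fin.< opposite j → j Fin.< i
  opposite-cancel-< {n} i j lt = ℕ.≰⇒> λ i≤j → ℕ.<⇒≱ lt
    (subst₂ _≤_ (sym (Fin.opposite-prop j)) (sym (Fin.opposite-prop i)) (ℕ.∸-monoʳ-≤ n (s≤s i≤j)))

  module _ {a b : ℕ} where

    site : Cell a b → Site
    site (top j) = upper (toℕ j)
    site (bot j) = lower (toℕ j)

    site-injective : ∀ {c c′} → site c ≡ site c′ → c ≡ c′
    site-injective {top i} {top j} eq = cong top (Fin.toℕ-injective (upper-injective eq))
    site-injective {bot i} {bot j} eq = cong bot (Fin.toℕ-injective (lower-injective eq))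
    site-injective {top i} {bot j} ()
    site-injective {bot i} {top j} ()

    cell : (s : Site) → .(Inside a b s) → Cell a b
    cell (upper j) j<a = top (fromℕ< j<a)
    cell (lower j) j<b = bot (fromℕ< j<b)

    site-inside : (c : Cell a b) → Inside a b (site c)
    site-inside (top j) = Fin.toℕ<n j
    site-inside (bot j) = Fin.toℕ<n j

    site-cell : ∀ s .(s-in : Inside a b s) → site (cell s s-in) ≡ s
    site-cell (upper j) j<a = cong upper (Fin.toℕ-fromℕ< j<a)
    site-cell (lower j) j<b = cong lower (Fin.toℕ-fromℕ< j<b)

    cell-site : ∀ c .(c-in : Inside a b (site c)) → cell (site c) c-in ≡ c
    cell-site (top j) j<a = cong top (Fin.fromℕ<-toℕ j j<a)
    cell-site (bot j) j<b = cong bot (Fin.fromℕ<-toℕ j j<b)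

    cell-cong : ∀ {s s′} .{s-in : Inside a b s} .{s′-in : Inside a b s′} →
                s ≡ s′ → cell s s-in ≡ cell s′ s′-in
    cell-cong refl = refl

    ≼-site : ∀ c c′ → (site c ≼ site c′) ≡ (row c ≤ row c′ × col c ≤ col c′)
    ≼-site (top _) (top _) = refl
    ≼-site (top _) (bot _) = refl
    ≼-site (bot _) (top _) = refl
    ≼-site (bot _) (bot _) = refl

  module _ {n a b : ℕ} where

    Nonempty Increasing : Vec (Cell a b) n → Set
    Nonempty fill = ∀ c → ∃ λ x → lookup fill x ≡ c
    Increasing fill = ∀ x y → lookup fill x ≢ lookup fill y → row (lookup fill x) ≤ row (lookup fill y) →
                      col (lookup fill x) ≤ col (lookup fill y) → x Fin.< y

    reversedSites : Vec (Cell a b) n → Vec Site n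
    reversedSites fill = tabulate (site ∘ lookup fill ∘ opposite)

    lookup-reversedSites : ∀ fill i → lookup (reversedSites fill) i ≡ site (lookup fill (opposite i))
    lookup-reversedSites fill = Vec.lookup∘tabulate (site ∘ lookup fill ∘ opposite)

    reversedSites-isReversedTableau : ∀ fill → Nonempty fill → Increasing fill →
                                      IsReversedTableau a b (reversedSites fill)
    reversedSites-isReversedTableau fill nonempty increasing = record
      { inside     = λ i → subst (Inside a b) (sym (rev i)) (site-inside _)
      ; onto       = onto′
      ; decreasing = decreasing′
      }
      where
      rev = lookup-reversedSites fill
      onto′ : ∀ s → Inside a b s → Occurs s (reversedSites fill)
      onto′ s s-in = let x , eq = nonempty (cell s s-in) in opposite x , (begin
        lookup (reversedSites fill) (opposite x)     ≡⟨ rev (opposite x) ⟩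
        site (lookup fill (opposite (opposite x)))   ≡⟨ cong (site ∘ lookup fill) (Fin.opposite-involutive x) ⟩
        site (lookup fill x)                         ≡⟨ cong site eq ⟩
        site (cell s s-in)                           ≡⟨ site-cell s s-in ⟩
        s                                            ∎)
      decreasing′ : ∀ i j → lookup (reversedSites fill) i ≢ lookup (reversedSites fill) j →
                    lookup (reversedSites fill) i ≼ lookup (reversedSites fill) j → j Fin.< i
      decreasing′ i j ne le = opposite-cancel-< i j (increasing (opposite i) (opposite j)
        (λ eq → ne (trans (rev i) (trans (cong site eq) (sym (rev j)))))
        (proj₁ le′) (proj₂ le′))
        where
        le′ = subst (λ X → X) (≼-site (lookup fill (opposite i)) (lookup fill (opposite j)))
                    (subst₂ _≼_ (rev i) (rev j) le)

    fillOf : (v : Vec Site n) → .(IsReversedTableau a b v) → Vec (Cell a b) n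
    fillOf v p = tabulate (λ x → cell (lookup v (opposite x)) (inside p (opposite x)))

    site-lookup-fillOf : ∀ v .(p : IsReversedTableau a b v) x →
                         site (lookup (fillOf v p) x) ≡ lookup v (opposite x)
    site-lookup-fillOf v p x = trans (cong site (Vec.lookup∘tabulate _ x)) (site-cell _ _)

    fillOf-nonempty : ∀ v (p : IsReversedTableau a b v) → Nonempty (fillOf v p)
    fillOf-nonempty v p c = let i , eq = onto p (site c) (site-inside c) in opposite i , (begin
      lookup (fillOf v p) (opposite i)
        ≡⟨ Vec.lookup∘tabulate _ (opposite i) ⟩
      cell (lookup v (opposite (opposite i))) _
        ≡⟨ cell-cong (trans (cong (lookup v) (Fin.opposite-involutive i)) eq) ⟩
      cell (site c) (site-inside c)
        ≡⟨ cell-site c (site-inside c) ⟩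
      c ∎)

    fillOf-increasing : ∀ v (p : IsReversedTableau a b v) → Increasing (fillOf v p)
    fillOf-increasing v p x y ne r≤ c≤ = opposite-cancel-< y x (decreasing p (opposite x) (opposite y)
      (λ eq → ne (site-injective (trans (fs x) (trans eq (sym (fs y))))))
      (subst₂ _≼_ (fs x) (fs y)
        (subst (λ X → X) (sym (≼-site (lookup (fillOf v p) x) (lookup (fillOf v p) y))) (r≤ , c≤))))
      where
      fs = site-lookup-fillOf v p

    reversedSites-fillOf : ∀ v .(p : IsReversedTableau a b v) → reversedSites (fillOf v p) ≡ v
    reversedSites-fillOf v p = trans
      (Vec.tabulate-cong λ i →
        trans (site-lookup-fillOf v p (opposite i)) (cong (lookup v) (Fin.opposite-involutive i)))
      (Vec.tabulate∘lookup v)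

    fillOf-reversedSites : ∀ fill .(p : IsReversedTableau a b (reversedSites fill)) →
                           fillOf (reversedSites fill) p ≡ fill
    fillOf-reversedSites fill p = trans
      (Vec.tabulate-cong λ x → trans
        (cell-cong (trans (lookup-reversedSites fill (opposite x))
                          (cong (site ∘ lookup fill) (Fin.opposite-involutive x))))
        (cell-site (lookup fill x) (site-inside (lookup fill x))))
      (Vec.tabulate∘lookup fill)

    SVT↔ReversedTableaux : SVT n a b ↔ ReversedTableaux n a b
    SVT↔ReversedTableaux = mk↔ₛ′
      (λ { (svt fill nonempty increasing) →
             reversedSites fill , [ reversedSites-isReversedTableau fill nonempty increasing ] })
      (λ { (v , [ p ]) → svt (fillOf v p) (fillOf-nonempty v p) (fillOf-increasing v p) })
      (λ { (v , [ p ]) → ReversedTableaux-≡ (reversedSites-fillOf v p) })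
      (λ { (svt fill nonempty increasing) →
             cong-svt (fillOf-reversedSites fill (reversedSites-isReversedTableau fill nonempty increasing)) })
      where
      cong-svt : ∀ {f f′ : Vec (Cell a b) n} .{ne ne′ inc inc′} →
                 f ≡ f′ → svt f ne inc ≡ svt f′ ne′ inc′
      cong-svt refl = refl

  Tableaux↔Growths : ∀ {n t} → Tableaux n t ↔ Growths n t
  Tableaux↔Growths {t = t} =
    congˡ λ {e} → ↔-trans SVT↔ReversedTableaux (↔-sym (Growth↔ReversedTableaux e t))

module Enumeration where

  open import Data.Nat using (_+_)
  open import Data.Fin using (zero; suc; splitAt)
  import Data.Fin.Properties as Fin
  open import Data.Fin.Permutation using (↔⇒≡)
  open import Data.Sum as Sum using (_⊎_; inj₁; inj₂; [_,_]′)
  open import Data.Sum.Function.Propositional using (_⊎-cong_)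
  open import Data.Empty using (⊥; ⊥-elim)
  open import Function using (_∘_)
  open import Function.Bundles using (mk↔ₛ′)
  open import Function.Properties.Inverse using (↔-sym; ↔-trans)
  open import Algebra.Properties.CommutativeMonoid.Sum ℕ.+-0-commutativeMonoid
    using (sum; sum-permute; sum-cong-≗)
  open import Algebra.Properties.CommutativeSemigroup ℕ.+-commutativeSemigroup using (x∙yz≈y∙xz)
  open Inverse

  record Count {A : Set} (w : A → ℕ) (k s : ℕ) : Set where
    constructor counted
    field
      enumeration : Fin k ↔ A
      weight-sum  : sum (w ∘ to enumeration) ≡ s

  count-unique : ∀ {A} {w : A → ℕ} {k k′ s s′} →
                 Count w k s → Count w k′ s′ → k ≡ k′ × s ≡ s′
  count-unique {w = w} (counted ψ ψ-sum) (counted ψ′ ψ′-sum) = ↔⇒≡ π , (begin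
    _                               ≡⟨ ψ-sum ⟨
    sum (w ∘ to ψ)                  ≡⟨ sum-cong-≗ (λ i → cong w (strictlyInverseˡ ψ′ (to ψ i))) ⟨
    sum (w ∘ to ψ′ ∘ to π)           ≡⟨ sum-permute (w ∘ to ψ′) π ⟨
    sum (w ∘ to ψ′)                 ≡⟨ ψ′-sum ⟩
    _                               ∎)
    where
      π = ↔-trans ψ (↔-sym ψ′)

  count-↔ : ∀ {A B} {w : A → ℕ} {w′ : B → ℕ} {k s} (e : B ↔ A) →
            (∀ b → w′ b ≡ w (to e b)) → Count w k s → Count w′ k s
  count-↔ {w = w} e w′≗ (counted ψ ψ-sum) = counted (↔-trans ψ (↔-sym e))
    (trans (sum-cong-≗ λ i → trans (w′≗ _) (cong w (strictlyInverseˡ e (to ψ i)))) ψ-sum)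

  sum-splitAt : ∀ m {n} (f : Fin m ⊎ Fin n → ℕ) →
                sum (f ∘ splitAt m) ≡ sum (f ∘ inj₁) + sum (f ∘ inj₂)
  sum-splitAt zero    f = refl
  sum-splitAt (suc m) f = trans (cong (λ x → f (inj₁ zero) + x) (sum-splitAt m (f ∘ Sum.map₁ suc)))
                                (sym (ℕ.+-assoc (f (inj₁ zero)) _ _))

  count-⊎ : ∀ {A B} {u : A → ℕ} {v : B → ℕ} {k l s r} →
            Count u k s → Count v l r → Count [ u , v ]′ (k + l) (s + r)
  count-⊎ {u = u} {v} {k} (counted ψ ψ-sum) (counted χ χ-sum) =
    counted (↔-trans Fin.+↔⊎ (ψ ⊎-cong χ))
            (trans (sum-splitAt k ([ u , v ]′ ∘ Sum.map (to ψ) (to χ))) (cong₂ _+_ ψ-sum χ-sum))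

  count-empty : ∀ {A} {w : A → ℕ} → (A → ⊥) → Count w 0 0
  count-empty ¬a = counted (mk↔ₛ′ (λ ()) (λ a → ⊥-elim (¬a a)) (λ a → ⊥-elim (¬a a)) (λ ())) refl

  sum-suc : ∀ {k} (f : Fin k → ℕ) → sum (suc ∘ f) ≡ k + sum f
  sum-suc {zero}  f = refl
  sum-suc {suc k} f =
    cong suc (trans (cong (λ x → f zero + x) (sum-suc (f ∘ suc))) (x∙yz≈y∙xz (f zero) k (sum (f ∘ suc))))

  count-suc : ∀ {A} {w : A → ℕ} {k s} → Count w k s → Count (suc ∘ w) k (k + s)
  count-suc {w = w} (counted ψ ψ-sum) = counted ψ (trans (sum-suc (w ∘ to ψ)) (cong (λ x → _ + x) ψ-sum))

module Counting where

  open Words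
  open Fillings using (Tableaux↔Growths)
  open Enumeration
  open import Data.Nat using (_+_; _≤′_; ≤′-refl; ≤′-step)
  open import Data.Fin using (zero; suc)
  import Data.List as List
  import Data.List.Properties as List
  import Data.Nat.ListAction as ListAction
  open import Algebra.Properties.CommutativeMonoid.Sum ℕ.+-0-commutativeMonoid using (sum)
  open import Data.Sum using (_⊎_; inj₁; inj₂)
  open import Function using (_∘_; const; id)
  open import Function.Bundles using (mk↔ₛ′)

  countFlat : ℕ → ℕ → ℕ
  countFlat zero    zero    = 1
  countFlat zero    (suc t) = 0
  countFlat (suc n) zero    = 0
  countFlat (suc n) (suc t) = countFlat n t + countFlat n (suc t)

  countTall countAll secondRowTotal : ℕ → ℕ → ℕ
  countTall zero    t       = 0
  countTall (suc n) zero    = countTall n 0 + countAll n 1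
  countTall (suc n) (suc t) = countTall n (suc t) + (countTall n t + (countTall n (suc t) + countAll n (2 + t)))
  countAll n t = countFlat n t + countTall n t
  secondRowTotal zero    t       = 0
  secondRowTotal (suc n) zero    = secondRowTotal n 0 + (countAll n 1 + secondRowTotal n 1)
  secondRowTotal (suc n) (suc t) =
    secondRowTotal n (suc t)
    + (secondRowTotal n t + (secondRowTotal n (suc t) + (countAll n (2 + t) + secondRowTotal n (2 + t))))

  Growths↔ : ∀ {n t} → Growths n t ↔ (Growth n 0 t ⊎ TallGrowths n t)
  Growths↔ = mk↔ₛ′ (λ { (zero , g) → inj₁ g ; (suc e , g) → inj₂ (e , g) })
                   (λ { (inj₁ g) → 0 , g ; (inj₂ (e , g)) → suc e , g })
                   (λ { (inj₁ g) → refl ; (inj₂ (e , g)) → refl })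
                   (λ { (zero , g) → refl ; (suc e , g) → refl })

  flat-suc↔ : ∀ {n t} → Growth (suc n) 0 (suc t) ↔ (Growth n 0 t ⊎ Growth n 0 (suc t))
  flat-suc↔ = mk↔ₛ′ (λ { (openTop g) → inj₁ g ; (joinTop g) → inj₂ g })
                    (λ { (inj₁ g) → openTop g ; (inj₂ g) → joinTop g })
                    (λ { (inj₁ g) → refl ; (inj₂ g) → refl })
                    (λ { (openTop g) → refl ; (joinTop g) → refl })

  tall-zero↔ : ∀ {n} → TallGrowths (suc n) 0 ↔ (TallGrowths n 0 ⊎ Growths n 1)
  tall-zero↔ = mk↔ₛ′ (λ { (e , joinBot g) → inj₁ (e , g) ; (e , openBot g) → inj₂ (e , g) })
                     (λ { (inj₁ (e , g)) → e , joinBot g ; (inj₂ (e , g)) → e , openBot g })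
                     (λ { (inj₁ _) → refl ; (inj₂ _) → refl })
                     (λ { (e , joinBot g) → refl ; (e , openBot g) → refl })

  tall-suc↔ : ∀ {n t} → TallGrowths (suc n) (suc t) ↔
              (TallGrowths n (suc t) ⊎ (TallGrowths n t ⊎ (TallGrowths n (suc t) ⊎ Growths n (2 + t))))
  tall-suc↔ = mk↔ₛ′
    (λ { (e , joinTop g) → inj₁ (e , g) ; (e , openTop g) → inj₂ (inj₁ (e , g))
       ; (e , joinBot g) → inj₂ (inj₂ (inj₁ (e , g))) ; (e , openBot g) → inj₂ (inj₂ (inj₂ (e , g))) })
    (λ { (inj₁ (e , g)) → e , joinTop g ; (inj₂ (inj₁ (e , g))) → e , openTop g
       ; (inj₂ (inj₂ (inj₁ (e , g)))) → e , joinBot g ; (inj₂ (inj₂ (inj₂ (e , g)))) → e , openBot g })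
    (λ { (inj₁ _) → refl ; (inj₂ (inj₁ _)) → refl
       ; (inj₂ (inj₂ (inj₁ _))) → refl ; (inj₂ (inj₂ (inj₂ _))) → refl })
    (λ { (e , joinTop g) → refl ; (e , openTop g) → refl ; (e , joinBot g) → refl ; (e , openBot g) → refl })

  count-flat : ∀ n t → Count {Growth n 0 t} (const 0) (countFlat n t) 0
  count-flat zero    zero    =
    counted (mk↔ₛ′ (λ _ → start) (λ _ → zero) (λ { start → refl }) (λ { zero → refl })) refl
  count-flat zero    (suc t) = count-empty λ ()
  count-flat (suc n) zero    = count-empty λ ()
  count-flat (suc n) (suc t) = count-↔ flat-suc↔ (λ { (joinTop _) → refl ; (openTop _) → refl })
                                 (count-⊎ (count-flat n t) (count-flat n (suc t)))

  count-tall : ∀ n t → Count {TallGrowths n t} (suc ∘ proj₁) (countTall n t) (secondRowTotal n t)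
  count-growths : ∀ n t → Count {Growths n t} proj₁ (countAll n t) (secondRowTotal n t)
  count-tall zero    t       = count-empty λ { (_ , ()) }
  count-tall (suc n) zero    = count-↔ tall-zero↔ (λ { (e , joinBot _) → refl ; (e , openBot _) → refl })
                                 (count-⊎ (count-tall n 0) (count-suc (count-growths n 1)))
  count-tall (suc n) (suc t) = count-↔ tall-suc↔
    (λ { (e , joinTop _) → refl ; (e , openTop _) → refl ; (e , joinBot _) → refl ; (e , openBot _) → refl })
    (count-⊎ (count-tall n (suc t)) (count-⊎ (count-tall n t)
      (count-⊎ (count-tall n (suc t)) (count-suc (count-growths n (2 + t))))))
  count-growths n t = count-↔ Growths↔ (λ { (zero , _) → refl ; (suc e , _) → refl })
                        (count-⊎ (count-flat n t) (count-tall n t))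

  count-tableaux : ∀ n t → Count {Tableaux n t} proj₁ (countAll n t) (secondRowTotal n t)
  count-tableaux n t = count-↔ Tableaux↔Growths (λ _ → refl) (count-growths n t)

  sum-tabulate : ∀ {k} (f : Fin k → ℕ) → ListAction.sum (List.tabulate f) ≡ sum f
  sum-tabulate {zero}  f = refl
  sum-tabulate {suc k} f = cong (λ x → f zero + x) (sum-tabulate (f ∘ suc))

  count-enumeration : ∀ {n t N} (φ : Fin N ↔ Tableaux n t) → Count proj₁ N (secondRowSum φ)
  count-enumeration φ = counted φ (sym (trans
    (cong ListAction.sum (List.map-tabulate id (proj₁ ∘ Inverse.to φ))) (sum-tabulate (proj₁ ∘ Inverse.to φ))))

  filledRow : ∀ {n t} → t ≤′ n → Growth (suc n) 0 (suc t)
  filledRow ≤′-refl     = openRow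
    where
    openRow : ∀ {t} → Growth t 0 t
    openRow {zero}  = start
    openRow {suc t} = openTop openRow
  filledRow (≤′-step p) = joinTop (filledRow p)

  growth-exists : ∀ n t → t ≤ 2 ℕ.+ n → Growths (2 ℕ.+ n) t
  growth-exists n zero    _         = 1 , openBot (filledRow (ℕ.≤⇒≤′ (z≤n {n})))
  growth-exists n (suc t) (s≤s t≤n) = 0 , filledRow (ℕ.≤⇒≤′ t≤n)

module Recurrences where

  open Binomials
  open ClosedForms
  open Counting
  open import Data.Integer using (_+_; -_)
  open import Algebra.Properties.AbelianGroup ℤ.+-0-abelianGroup using (∙-cancelʳ)
  import Data.Integer.Tactic.RingSolver as ℤ-Solver

  countFlat-closed : ∀ n t → + countFlat (suc n) t ≡ choose n (ℤ.pred (+ t))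
  countFlat-closed zero    zero          = refl
  countFlat-closed zero    (suc zero)    = refl
  countFlat-closed zero    (suc (suc t)) = refl
  countFlat-closed (suc n) zero          = refl
  countFlat-closed (suc n) (suc t)       = begin
    + countFlat (suc n) t + + countFlat (suc n) (suc t)
      ≡⟨ cong₂ _+_ (countFlat-closed n t) (countFlat-closed n (suc t)) ⟩
    choose n (ℤ.pred (+ t)) + choose n (+ t)
      ≡⟨ choose-suc n (+ t) ⟨
    choose (suc n) (+ t) ∎

  countAll-smooth : ∀ n t →
    + countAll (suc n) t + + countFlat n t ≡ smooth (oddExtension (countAll n)) (+ t)
  countAll-smooth n zero    = lemma (+ countFlat n 0) (+ countTall n 0) (+ countAll n 1)
    where
    lemma : ∀ f p a₁ → p + a₁ + f ≡ - (f + p) + + 2 * (f + p) + a₁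
    lemma = ℤ-Solver.solve-∀
  countAll-smooth n (suc t) = lemma (+ countFlat n t) (+ countFlat n (suc t))
                                     (+ countTall n t) (+ countTall n (suc t)) (+ countAll n (2 ℕ.+ t))
    where
    lemma : ∀ f₀ f₁ p₀ p₁ a₂ →
            f₀ + f₁ + (p₁ + (p₀ + (p₁ + a₂))) + f₁ ≡ f₀ + p₀ + + 2 * (f₁ + p₁) + a₂
    lemma = ℤ-Solver.solve-∀

  secondRowTotal-smooth : ∀ n t →
    + secondRowTotal (suc n) t ≡ smooth (oddExtension (secondRowTotal n)) (+ t) + + countAll n (suc t)
  secondRowTotal-smooth n zero    = lemma (+ secondRowTotal n 0) (+ secondRowTotal n 1) (+ countAll n 1)
    where
    lemma : ∀ q₀ q₁ a₁ → q₀ + (a₁ + q₁) ≡ - q₀ + + 2 * q₀ + q₁ + a₁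
    lemma = ℤ-Solver.solve-∀
  secondRowTotal-smooth n (suc t) =
    lemma (+ secondRowTotal n t) (+ secondRowTotal n (suc t)) (+ secondRowTotal n (2 ℕ.+ t))
          (+ countAll n (2 ℕ.+ t))
    where
    lemma : ∀ q₀ q₁ q₂ a₂ → q₁ + (q₀ + (q₁ + (a₂ + q₂))) ≡ q₀ + + 2 * q₁ + q₂ + a₂
    lemma = ℤ-Solver.solve-∀

  countAll≡countFormula : ∀ m t → + countAll (3 ℕ.+ m) t ≡ countFormula m (+ t)
  countAll≡countFormula zero    zero                      = refl
  countAll≡countFormula zero    (suc zero)                = refl
  countAll≡countFormula zero    (suc (suc zero))          = refl
  countAll≡countFormula zero    (suc (suc (suc zero)))    = refl
  countAll≡countFormula zero    (suc (suc (suc (suc t)))) = refl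
  countAll≡countFormula (suc m) t = ∙-cancelʳ (+ countFlat (3 ℕ.+ m) t) _ _ (begin
    + countAll (4 ℕ.+ m) t + + countFlat (3 ℕ.+ m) t
      ≡⟨ countAll-smooth (3 ℕ.+ m) t ⟩
    smooth (oddExtension (countAll (3 ℕ.+ m))) (+ t)
      ≡⟨ smooth-oddExtension {g = countFormula m} (countAll≡countFormula m) (countFormula-odd m) t ⟩
    smooth (countFormula m) (+ t)
      ≡⟨ countFormula-smooth m (+ t) ⟩
    countFormula (suc m) (+ t) + choose (2 ℕ.+ m) (ℤ.pred (+ t))
      ≡⟨ cong (λ x → countFormula (suc m) (+ t) + x) (countFlat-closed (2 ℕ.+ m) t) ⟨
    countFormula (suc m) (+ t) + + countFlat (3 ℕ.+ m) t ∎)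

  secondRowTotal≡totalFormula : ∀ m t → + secondRowTotal (3 ℕ.+ m) t ≡ totalFormula m (+ t)
  secondRowTotal≡totalFormula zero    zero                      = refl
  secondRowTotal≡totalFormula zero    (suc zero)                = refl
  secondRowTotal≡totalFormula zero    (suc (suc zero))          = refl
  secondRowTotal≡totalFormula zero    (suc (suc (suc zero)))    = refl
  secondRowTotal≡totalFormula zero    (suc (suc (suc (suc t)))) = refl
  secondRowTotal≡totalFormula (suc m) t = begin
    + secondRowTotal (4 ℕ.+ m) t
      ≡⟨ secondRowTotal-smooth (3 ℕ.+ m) t ⟩
    smooth (oddExtension (secondRowTotal (3 ℕ.+ m))) (+ t) + + countAll (3 ℕ.+ m) (suc t)
      ≡⟨ cong₂ _+_ (smooth-oddExtension {g = totalFormula m} (secondRowTotal≡totalFormula m)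
                                         (totalFormula-odd m) t)
                   (countAll≡countFormula m (suc t)) ⟩
    smooth (totalFormula m) (+ t) + countFormula m (+ suc t)
      ≡⟨ totalFormula-smooth m (+ t) ⟩
    totalFormula (suc m) (+ t) ∎

open ClosedForms using (countFormula; denom≡countFormula; numer≡totalFormula)
open Fillings using (Tableaux↔Growths)
open Enumeration using (count-unique)
open Counting using (countAll; secondRowTotal; count-enumeration; count-tableaux; growth-exists)
open Recurrences using (countAll≡countFormula; secondRowTotal≡totalFormula)

theorem5 : (n t : ℕ) → 3 ≤ n → t ≤ n →
           (N : ℕ) (φ : Fin N ↔ Tableaux n t) →
           (denom n t ≢ 0ℤ) × (+ secondRowSum φ * denom n t ≡ numer n t * + N)
theorem5 n@(suc (suc (suc m))) t (s≤s (s≤s (s≤s z≤n))) t≤n N φ = denom≢0 , (begin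
  + secondRowSum φ * denom n t
    ≡⟨ cong₂ _*_ (cong +_ sum≡) (trans (denom≡countFormula m t) (sym (countAll≡countFormula m t))) ⟩
  + secondRowTotal n t * + countAll n t
    ≡⟨ cong₂ _*_ (trans (secondRowTotal≡totalFormula m t) (sym (numer≡totalFormula m t))) (cong +_ (sym N≡)) ⟩
  numer n t * + N ∎)
  where
  counts : N ≡ countAll n t × secondRowSum φ ≡ secondRowTotal n t
  counts = count-unique (count-enumeration φ) (count-tableaux n t)
  N≡ = proj₁ counts
  sum≡ = proj₂ counts
  N≢0 : N ≢ 0
  N≢0 N≡0 with subst Fin N≡0 (Inverse.from φ (Inverse.from Tableaux↔Growths (growth-exists (suc m) t t≤n)))
  ... | ()
  denom≢0 : denom n t ≢ 0ℤ
  denom≢0 denom≡0 = N≢0 (ℤ.+-injective (begin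
    + N                   ≡⟨ cong +_ N≡ ⟩
    + countAll n t        ≡⟨ countAll≡countFormula m t ⟩
    countFormula m (+ t)  ≡⟨ denom≡countFormula m t ⟨
    denom n t             ≡⟨ denom≡0 ⟩
    0ℤ                    ∎))
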